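{- If $n_1, n_2, n_3$ are positive even integers, then $\mathrm{ip}(K_{n_1} \Box K_{n_2} \Box K_{n_3}) = n_1 n_2 n_3/4$.
   Context: An isometric path between two vertices of a graph is a shortest path joining them. The isometric path number $\mathrm{ip}(G)$ of a graph $G$ is the minimum number of isometric paths needed to cover all vertices of $G$. $K_m$ denotes the complete graph on $m$ vertices. The Cartesian product $K_{n_1} \Box \cdots \Box K_{n_r}$ has vertex set $\{(x_1,\ldots,x_r) : 0 \le x_i < n_i\}$, with two vertices adjacent if and only if they differ in exactly one coordinate. -}

module Defs where

open import Data.Nat using (ℕ; zero; suc; _≤_)
open import Data.Fin using (Fin)
open import Data.List using (List; []; _∷_)
open import Data.Product using (Σ; ∃; _×_; _,_)
open import Data.Sum using (_⊎_)
open import Data.Unit using (⊤)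
open import Data.Empty using (⊥)
open import Relation.Binary.PropositionalEquality using (_≡_; _≢_)

record Graph : Set₁ where
  field
    V   : Set
    Adj : V → V → Set
open Graph public

data Walk (G : Graph) : V G → V G → ℕ → Set where
  here : ∀ {u} → Walk G u u zero
  step : ∀ {u w v ℓ} → Adj G u w → Walk G w v ℓ → Walk G u v (suc ℓ)

data OnWalk (G : Graph) (x : V G) : ∀ {u v ℓ} → Walk G u v ℓ → Set where
  on-here  : ∀ {v ℓ} (p : Walk G x v ℓ) → OnWalk G x p
  on-later : ∀ {u w v ℓ} (e : Adj G u w) (p : Walk G w v ℓ) →
             OnWalk G x p → OnWalk G x (step e p)

record IsoPath (G : Graph) : Set where
  constructor isoPath
  field
    start end : V G
    len       : ℕ
    walk      : Walk G start end len
    shortest  : ∀ {m} → Walk G start end m → len ≤ m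
open IsoPath public

IsoPathCover : Graph → ℕ → Set
IsoPathCover G k =
  Σ (Fin k → IsoPath G) λ P → (x : V G) → ∃ λ i → OnWalk G x (walk (P i))

IsometricPathNumber : Graph → ℕ → Set
IsometricPathNumber G k = IsoPathCover G k × (∀ j → IsoPathCover G j → k ≤ j)

-- Cartesian product K_{n_1} □ ... □ K_{n_r} of complete graphs.
KVertex : List ℕ → Set
KVertex []       = ⊤
KVertex (n ∷ ns) = Fin n × KVertex ns

KAdj : (ns : List ℕ) → KVertex ns → KVertex ns → Set
KAdj []       _        _        = ⊥
KAdj (n ∷ ns) (x , xs) (y , ys) = (x ≢ y × xs ≡ ys) ⊎ (x ≡ y × KAdj ns xs ys)

KProd : List ℕ → Graph
KProd ns = record { V = KVertex ns ; Adj = KAdj ns }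

{-# OPTIONS --safe #-}
-- The graph distance of K_{n₁} □ ⋯ □ K_{n_r} is the Hamming distance, so an isometric
-- path has at most r + 1 vertices; with r = 3, covering n₁n₂n₃ vertices needs at least
-- n₁n₂n₃/4 paths. Conversely, splitting each K_{2a} into a copies of K₂ partitions
-- K_{2a} □ K_{2b} □ K_{2c} into abc cubes K₂ □ K₂ □ K₂, each of which is isometric in the
-- whole graph and is covered by two antipodal geodesics of length 3.
module Submission where

open import Defs
open import Data.Nat using (ℕ; _*_; _<_; _/_)
open import Data.Nat.Divisibility using (_∣_)
open import Data.List using (_∷_; [])

open import Data.Nat using (zero; suc; _+_; _≤_; z≤n; s≤s)
open import Data.Nat.Properties
  using (≤-refl; ≤-reflexive; ≤-trans; +-mono-≤; +-monoˡ-≤; +-monoʳ-≤; +-suc; m≤n+m;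
         module ≤-Reasoning)
open import Data.Nat.DivMod using (m*n/n≡m; /-monoˡ-≤)
open import Data.Nat.Divisibility using (divides-refl)
open import Data.Nat.ListAction using (product)
open import Data.Nat.Solver using (module +-*-Solver)
open import Data.Fin using (Fin; fromℕ<; combine; remQuot)
open import Data.Fin.Patterns using (0F; 1F)
open import Data.Fin.Properties
  using (_≟_; 1↔⊤; *↔×; fromℕ<-injective; combine-injective; combine-injectiveʳ;
         combine-remQuot; injective⇒≤)
open import Data.List using (List; length; map; replicate)
open import Data.Product using (∃; ∃₂; _×_; _,_; proj₁; proj₂)
open import Data.Product.Function.NonDependent.Propositional using (_×-↔_)
open import Data.Sum using (inj₁; inj₂)
open import Data.Unit using (tt)
open import Function using (_∘_)
open import Function.Bundles using (_↔_; _↣_; Inverse; Injection)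
open import Function.Properties.Inverse using (↔-refl; ↔-sym; ↔-trans; ↔⇒↣)
open import Relation.Nullary using (yes; no; contradiction)
open import Relation.Binary.PropositionalEquality
  using (_≡_; _≢_; refl; sym; cong; cong₂; subst; module ≡-Reasoning)

module _ {G : Graph} where

  at : ∀ {u v ℓ} → Walk G u v ℓ → ℕ → V G
  at {u = u} _          zero    = u
  at {u = u} here       (suc _) = u
  at         (step _ p) (suc t) = at p t

  onWalk⇒at : ∀ {x u v ℓ} {p : Walk G u v ℓ} → OnWalk G x p → ∃ λ t → t ≤ ℓ × at p t ≡ x
  onWalk⇒at (on-here _) = 0 , z≤n , refl
  onWalk⇒at (on-later _ _ x∈p) with onWalk⇒at x∈p
  ... | t , t≤ℓ , refl = suc t , s≤s t≤ℓ , refl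

module _ {G H : Graph} (f : V G → V H) (f-adj : ∀ {u v} → Adj G u v → Adj H (f u) (f v)) where

  mapWalk : ∀ {u v ℓ} → Walk G u v ℓ → Walk H (f u) (f v) ℓ
  mapWalk here       = here
  mapWalk (step e p) = step (f-adj e) (mapWalk p)

  mapWalk-onWalk : ∀ {x u v ℓ} {p : Walk G u v ℓ} → OnWalk G x p → OnWalk H (f x) (mapWalk p)
  mapWalk-onWalk (on-here p)        = on-here (mapWalk p)
  mapWalk-onWalk (on-later e p x∈p) = on-later (f-adj e) (mapWalk p) (mapWalk-onWalk x∈p)

IsoPathCover-reindex : ∀ {G k} {I : Set} → Fin k ↔ I → (P : I → IsoPath G) →
                       (∀ x → ∃ λ i → OnWalk G x (walk (P i))) → IsoPathCover G k
IsoPathCover-reindex {G} k↔I P cover = P ∘ to , covered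
  where
  open Inverse k↔I
  covered : ∀ x → ∃ λ i → OnWalk G x (walk (P (to i)))
  covered x = let (i , x∈Pi) = cover x in
    from i , subst (OnWalk G x ∘ walk ∘ P) (sym (strictlyInverseˡ i)) x∈Pi

cover-size-bound : ∀ {G N D j} → Fin N ↣ V G → (∀ (P : IsoPath G) → len P ≤ D) →
                   IsoPathCover G j → N ≤ j * suc D
cover-size-bound {G} {N} {D} {j} enum len≤D (P , cover) =
  injective⇒≤ {f = slot ∘ Injection.to enum} (Injection.injective enum ∘ slot-injective)
  where
  pathOf : V G → Fin j
  pathOf x = proj₁ (cover x)

  located : ∀ x → ∃ λ t → t ≤ len (P (pathOf x)) × at (walk (P (pathOf x))) t ≡ x
  located x = onWalk⇒at (proj₂ (cover x))

  position : V G → ℕ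
  position x = proj₁ (located x)

  position<1+D : ∀ x → position x < suc D
  position<1+D x = s≤s (≤-trans (proj₁ (proj₂ (located x))) (len≤D (P (pathOf x))))

  slot : V G → Fin (j * suc D)
  slot x = combine (pathOf x) (fromℕ< (position<1+D x))

  slot-injective : ∀ {x y} → slot x ≡ slot y → x ≡ y
  slot-injective {x} {y} same-slot = begin
    x                                     ≡⟨ sym (proj₂ (proj₂ (located x))) ⟩
    at (walk (P (pathOf x))) (position x) ≡⟨ cong₂ (λ i t → at (walk (P i)) t) same-path same-position ⟩
    at (walk (P (pathOf y))) (position y) ≡⟨ proj₂ (proj₂ (located y)) ⟩
    y                                     ∎
    where
    open ≡-Reasoning
    same-path : pathOf x ≡ pathOf y
    same-path = proj₁ (combine-injective _ _ _ _ same-slot)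
    same-position : position x ≡ position y
    same-position = fromℕ<-injective _ _ _ _ (proj₂ (combine-injective (pathOf x) _ (pathOf y) _ same-slot))

mismatch : ∀ {n} → Fin n → Fin n → ℕ
mismatch x y with x ≟ y
... | yes _ = 0
... | no  _ = 1

mismatch≤1 : ∀ {n} (x y : Fin n) → mismatch x y ≤ 1
mismatch≤1 x y with x ≟ y
... | yes _ = z≤n
... | no  _ = s≤s z≤n

mismatch-refl : ∀ {n} (x : Fin n) → mismatch x x ≡ 0
mismatch-refl x with x ≟ x
... | yes _   = refl
... | no  x≢x = contradiction refl x≢x

mismatch-≢ : ∀ {n} {x y : Fin n} → x ≢ y → mismatch x y ≡ 1
mismatch-≢ {x = x} {y} x≢y with x ≟ y
... | yes x≡y = contradiction x≡y x≢y
... | no  _   = refl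

mismatch-combineʳ : ∀ {m n} (b : Fin m) (x y : Fin n) → mismatch (combine b x) (combine b y) ≡ mismatch x y
mismatch-combineʳ b x y with x ≟ y
... | yes refl = mismatch-refl (combine b x)
... | no  x≢y  = mismatch-≢ (x≢y ∘ combine-injectiveʳ b x b y)

hamming : ∀ ns → KVertex ns → KVertex ns → ℕ
hamming []       _        _        = 0
hamming (n ∷ ns) (x , xs) (y , ys) = mismatch x y + hamming ns xs ys

hamming-refl : ∀ ns (u : KVertex ns) → hamming ns u u ≡ 0
hamming-refl []       _        = refl
hamming-refl (n ∷ ns) (x , xs) rewrite mismatch-refl x = hamming-refl ns xs

hamming≤length : ∀ ns (u v : KVertex ns) → hamming ns u v ≤ length ns
hamming≤length []       _        _        = z≤n
hamming≤length (n ∷ ns) (x , xs) (y , ys) = +-mono-≤ (mismatch≤1 x y) (hamming≤length ns xs ys)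

hamming-step : ∀ ns {u w} (v : KVertex ns) → KAdj ns u w → hamming ns u v ≤ suc (hamming ns w v)
hamming-step (n ∷ ns) {x , xs} {y , .xs} (z , zs) (inj₁ (_ , refl)) =
  ≤-trans (+-monoˡ-≤ (hamming ns xs zs) (mismatch≤1 x z)) (s≤s (m≤n+m (hamming ns xs zs) (mismatch y z)))
hamming-step (n ∷ ns) {x , xs} {.x , ys} (z , zs) (inj₂ (refl , xs~ys)) =
  ≤-trans (+-monoʳ-≤ (mismatch x z) (hamming-step ns zs xs~ys))
          (≤-reflexive (+-suc (mismatch x z) (hamming ns ys zs)))

hamming≤walk : ∀ ns {u v m} → Walk (KProd ns) u v m → hamming ns u v ≤ m
hamming≤walk ns {u} here             = ≤-reflexive (hamming-refl ns u)
hamming≤walk ns {v = v} (step e p) = ≤-trans (hamming-step ns v e) (s≤s (hamming≤walk ns p))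

consWalk : ∀ {n ns u v ℓ} (x : Fin n) → Walk (KProd ns) u v ℓ → Walk (KProd (n ∷ ns)) (x , u) (x , v) ℓ
consWalk {n} {ns} x = mapWalk {KProd ns} {KProd (n ∷ ns)} (x ,_) (λ u~v → inj₂ (refl , u~v))

geodesic : ∀ ns (u v : KVertex ns) → Walk (KProd ns) u v (hamming ns u v)
geodesic []       tt       tt       = here
geodesic (n ∷ ns) (x , xs) (y , ys) with x ≟ y
... | yes refl = consWalk x (geodesic ns xs ys)
... | no  x≢y  = step (inj₁ (x≢y , refl)) (consWalk y (geodesic ns xs ys))

isoPath-len≤length : ∀ ns (P : IsoPath (KProd ns)) → len P ≤ length ns
isoPath-len≤length ns P =
  ≤-trans (shortest P (geodesic ns (start P) (end P))) (hamming≤length ns (start P) (end P))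

mkIsoPath : ∀ ns {u v ℓ} → Walk (KProd ns) u v ℓ → ℓ ≤ hamming ns u v → IsoPath (KProd ns)
mkIsoPath ns p ℓ≤hamming = isoPath _ _ _ p (λ q → ≤-trans ℓ≤hamming (hamming≤walk ns q))

KVertex↔Fin : ∀ ns → KVertex ns ↔ Fin (product ns)
KVertex↔Fin []       = ↔-sym 1↔⊤
KVertex↔Fin (n ∷ ns) = ↔-trans (↔-refl ×-↔ KVertex↔Fin ns) (↔-sym *↔×)

isoPathCover-size : ∀ ns {j} → IsoPathCover (KProd ns) j → product ns ≤ j * suc (length ns)
isoPathCover-size ns = cover-size-bound (↔⇒↣ (↔-sym (KVertex↔Fin ns))) (isoPath-len≤length ns)

Cube : Graph
Cube = KProd (2 ∷ 2 ∷ 2 ∷ [])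

cube-cover : IsoPathCover Cube 2
cube-cover = diagonal , covered
  where
  other : Fin 2 → Fin 2
  other 0F = 1F
  other 1F = 0F

  other-≢ : ∀ x → x ≢ other x
  other-≢ 0F ()
  other-≢ 1F ()

  flip₁ : ∀ {x y z} → Adj Cube (x , y , z , tt) (other x , y , z , tt)
  flip₁ {x} = inj₁ (other-≢ x , refl)

  flip₂ : ∀ {x y z} → Adj Cube (x , y , z , tt) (x , other y , z , tt)
  flip₂ {y = y} = inj₂ (refl , inj₁ (other-≢ y , refl))

  flip₃ : ∀ {x y z} → Adj Cube (x , y , z , tt) (x , y , other z , tt)
  flip₃ {z = z} = inj₂ (refl , inj₂ (refl , inj₁ (other-≢ z , refl)))

  diagonal : Fin 2 → IsoPath Cube
  diagonal 0F = mkIsoPath _ {0F , 0F , 0F , tt} (step flip₁ (step flip₂ (step flip₃ here))) ≤-refl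
  diagonal 1F = mkIsoPath _ {0F , 1F , 0F , tt} (step flip₃ (step flip₂ (step flip₁ here))) ≤-refl

  covered : ∀ x → ∃ λ i → OnWalk Cube x (walk (diagonal i))
  covered (0F , 0F , 0F , tt) = 0F , on-here _
  covered (1F , 0F , 0F , tt) = 0F , on-later _ _ (on-here _)
  covered (1F , 1F , 0F , tt) = 0F , on-later _ _ (on-later _ _ (on-here _))
  covered (1F , 1F , 1F , tt) = 0F , on-later _ _ (on-later _ _ (on-later _ _ (on-here _)))
  covered (0F , 1F , 0F , tt) = 1F , on-here _
  covered (0F , 1F , 1F , tt) = 1F , on-later _ _ (on-here _)
  covered (0F , 0F , 1F , tt) = 1F , on-later _ _ (on-later _ _ (on-here _))
  covered (1F , 0F , 1F , tt) = 1F , on-later _ _ (on-later _ _ (on-later _ _ (on-here _)))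

module _ (m : ℕ) where

  Block Blown-up : List ℕ → Graph
  Block    ns = KProd (replicate (length ns) m)
  Blown-up ns = KProd (map (_* m) ns)

  inBlock : ∀ ns → KVertex ns → V (Block ns) → V (Blown-up ns)
  inBlock []       _       _        = tt
  inBlock (n ∷ ns) (b , β) (x , xs) = combine b x , inBlock ns β xs

  inBlock-adj : ∀ ns β {x y} → Adj (Block ns) x y → Adj (Blown-up ns) (inBlock ns β x) (inBlock ns β y)
  inBlock-adj (n ∷ ns) (b , β) (inj₁ (x≢y , refl)) = inj₁ (x≢y ∘ combine-injectiveʳ b _ b _ , refl)
  inBlock-adj (n ∷ ns) (b , β) (inj₂ (refl , xs~ys)) = inj₂ (refl , inBlock-adj ns β xs~ys)

  hamming-inBlock : ∀ ns β x y →
                    hamming (map (_* m) ns) (inBlock ns β x) (inBlock ns β y) ≡ hamming (replicate (length ns) m) x y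
  hamming-inBlock []       _       _        _        = refl
  hamming-inBlock (n ∷ ns) (b , β) (x , xs) (y , ys) =
    cong₂ _+_ (mismatch-combineʳ b x y) (hamming-inBlock ns β xs ys)

  inBlock-surjective : ∀ ns (v : V (Blown-up ns)) → ∃₂ λ β x → inBlock ns β x ≡ v
  inBlock-surjective []       tt       = tt , tt , refl
  inBlock-surjective (n ∷ ns) (y , ys) =
    let (b , x) = remQuot {n} m y
        (β , xs , β,xs↦ys) = inBlock-surjective ns ys
    in (b , β) , (x , xs) , cong₂ _,_ (combine-remQuot {n} m y) β,xs↦ys

  inBlock-isoPath : ∀ ns → KVertex ns → IsoPath (Block ns) → IsoPath (Blown-up ns)
  inBlock-isoPath ns β P =
    mkIsoPath (map (_* m) ns) (mapWalk (inBlock ns β) (inBlock-adj ns β) (walk P))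
      (≤-trans (shortest P (geodesic _ (start P) (end P)))
               (≤-reflexive (sym (hamming-inBlock ns β (start P) (end P)))))

  blown-up-cover : ∀ ns {k} → IsoPathCover (Block ns) k → IsoPathCover (Blown-up ns) (product ns * k)
  blown-up-cover ns {k} (P , cover) =
    IsoPathCover-reindex (↔-trans *↔× (↔-sym (KVertex↔Fin ns) ×-↔ ↔-refl)) Q covered
    where
    Q : KVertex ns × Fin k → IsoPath (Blown-up ns)
    Q (β , i) = inBlock-isoPath ns β (P i)

    covered : ∀ v → ∃ λ βi → OnWalk (Blown-up ns) v (walk (Q βi))
    covered v with inBlock-surjective ns v
    ... | β , x , refl =
      (β , proj₁ (cover x)) , mapWalk-onWalk (inBlock ns β) (inBlock-adj ns β) (proj₂ (cover x))

isoPathCover-size₃ : ∀ n₁ n₂ n₃ {j} → IsoPathCover (KProd (n₁ ∷ n₂ ∷ n₃ ∷ [])) j → n₁ * n₂ * n₃ / 4 ≤ j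
isoPathCover-size₃ n₁ n₂ n₃ {j} cover = begin
  n₁ * n₂ * n₃ / 4                ≡⟨ cong (_/ 4) (solve 3 (λ x y z →
                                        x :* y :* z := x :* (y :* (z :* con 1))) refl n₁ n₂ n₃) ⟩
  product (n₁ ∷ n₂ ∷ n₃ ∷ []) / 4 ≤⟨ /-monoˡ-≤ 4 (isoPathCover-size _ cover) ⟩
  j * 4 / 4                       ≡⟨ m*n/n≡m j 4 ⟩
  j                               ∎
  where
  open ≤-Reasoning
  open +-*-Solver

lemma7 : (n₁ n₂ n₃ : ℕ) → 0 < n₁ → 0 < n₂ → 0 < n₃ →
         2 ∣ n₁ → 2 ∣ n₂ → 2 ∣ n₃ →
         IsometricPathNumber (KProd (n₁ ∷ n₂ ∷ n₃ ∷ [])) ((n₁ * n₂ * n₃) / 4)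
lemma7 n₁ n₂ n₃ _ _ _ (divides-refl a) (divides-refl b) (divides-refl c) =
    subst (IsoPathCover (KProd (a * 2 ∷ b * 2 ∷ c * 2 ∷ []))) cubes≡n₁n₂n₃/4
          (blown-up-cover 2 (a ∷ b ∷ c ∷ []) cube-cover)
  , λ _ → isoPathCover-size₃ (a * 2) (b * 2) (c * 2)
  where
  open ≡-Reasoning
  open +-*-Solver
  cubes≡n₁n₂n₃/4 : product (a ∷ b ∷ c ∷ []) * 2 ≡ a * 2 * (b * 2) * (c * 2) / 4
  cubes≡n₁n₂n₃/4 = begin
    product (a ∷ b ∷ c ∷ []) * 2           ≡⟨ sym (m*n/n≡m _ 4) ⟩
    product (a ∷ b ∷ c ∷ []) * 2 * 4 / 4   ≡⟨ cong (_/ 4) (solve 3 (λ x y z →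
                                                x :* (y :* (z :* con 1)) :* con 2 :* con 4
                                                := x :* con 2 :* (y :* con 2) :* (z :* con 2)) refl a b c) ⟩
    a * 2 * (b * 2) * (c * 2) / 4          ∎
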